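{- Let $G=(V,E)$ be a simple graph with $V=[n]$ and let $u\in\{1,n\}$. If $\{w:\min\{u,v\}<w<\max\{u,v\}\}\subseteq N_G(u)\cup N_G(v)$ holds for every $v\in N_G(u)$, then $\mathcal{W}(G)=\emptyset$ if and only if $\mathcal{W}(G-u)=\emptyset$.
   Context: $N_G(v)$ is the set of neighbours of $v$ in $G$. For a simple graph $H$ whose vertex set is a set of positive integers, $\mathcal{W}(H)$ is the set of $3$-element vertex subsets $\{a,b,c\}$ with $a<b<c$ such that $ac$ is an edge and $ab$, $bc$ are non-edges. $G-u$ is the graph obtained by deleting $u$ (other vertices keep their labels). -}

module Defs where

open import Data.Nat using (ℕ; _<_; _≤_; _⊓_; _⊔_)
open import Data.Product using (_×_; Σ; ∃; ∃-syntax; _,_)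
open import Data.Sum using (_⊎_)
open import Data.Empty using (⊥)
open import Relation.Nullary using (¬_)
open import Relation.Binary.PropositionalEquality using (_≡_; _≢_)
open import Level using (0ℓ; suc)

record Graph : Set₁ where
  field
    Vert  : ℕ → Set
    Adj   : ℕ → ℕ → Set
    sym   : ∀ {x y} → Adj x y → Adj y x
    irrefl : ∀ {x} → ¬ Adj x x
    adj-vert : ∀ {x y} → Adj x y → Vert x × Vert y
open Graph public

InRange : ℕ → ℕ → Set
InRange n v = 1 ≤ v × v ≤ n

HasVertexSet : Graph → ℕ → Set
HasVertexSet G n = ∀ v → (Vert G v → InRange n v) × (InRange n v → Vert G v)

_∈N[_]_ : ℕ → Graph → ℕ → Set
w ∈N[ G ] v = Adj G v w

-- {a,b,c} ∈ 𝒲(H) with a < b < c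
IsW : Graph → ℕ → ℕ → ℕ → Set
IsW H a b c =
  (Vert H a × Vert H b × Vert H c) × (a < b × b < c) ×
  Adj H a c × ¬ Adj H a b × ¬ Adj H b c

WEmpty : Graph → Set
WEmpty H = ∀ a b c → ¬ IsW H a b c

delete : Graph → ℕ → Graph
delete G u = record
  { Vert = λ v → Vert G v × v ≢ u
  ; Adj = λ x y → Adj G x y × x ≢ u × y ≢ u
  ; sym = λ { (e , p , q) → sym G e , q , p }
  ; irrefl = λ { (e , _ , _) → irrefl G e }
  ; adj-vert = λ { (e , p , q) → let (vx , vy) = adj-vert G e in (vx , p) , (vy , q) }
  }

-- A triple of 𝒲(G) that misses u is a triple of 𝒲(G − u), and conversely, so only triples
-- through u matter. Since u is the least or the largest vertex, it is not the middle vertex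
-- of a triple. Nor is it an end of the edge ac: the other end is then a neighbour v of u,
-- and the middle vertex lies strictly between u and v, hence is adjacent to u or to v.
module Submission where

open import Defs
open import Data.Nat using (ℕ; _<_; _⊓_; _⊔_)
open import Data.Nat.Properties
  using (<⇒≤; <⇒≢; >⇒≢; <-trans; <-≤-trans; ≤-<-trans; ⊓-comm; ⊔-comm; m≤n⇒m⊓n≡m; m≤n⇒m⊔n≡n)
open import Data.Product using (_×_; _,_; proj₁; proj₂)
open import Data.Sum using (_⊎_; inj₁; inj₂; [_,_])
open import Relation.Binary.PropositionalEquality using (_≡_; _≢_; refl; subst)
open import Function.Bundles using (_⇔_; mk⇔)

NeighbourIntervalsCovered : Graph → ℕ → Set
NeighbourIntervalsCovered G u =
  ∀ v → v ∈N[ G ] u → ∀ w → (u ⊓ v) < w → w < (u ⊔ v) → (w ∈N[ G ] u ⊎ w ∈N[ G ] v)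

strictlyBetween⇒⊓<×<⊔ : ∀ {a b c} → a < b → b < c → a ⊓ c < b × b < a ⊔ c
strictlyBetween⇒⊓<×<⊔ a<b b<c
  rewrite m≤n⇒m⊓n≡m (<⇒≤ (<-trans a<b b<c)) | m≤n⇒m⊔n≡n (<⇒≤ (<-trans a<b b<c)) = a<b , b<c

IsW-delete⇒IsW : ∀ G u {a b c} → IsW (delete G u) a b c → IsW G a b c
IsW-delete⇒IsW G u (((va , a≢u) , (vb , b≢u) , (vc , c≢u)) , ord , (ac , _) , ¬ab , ¬bc) =
  (va , vb , vc) , ord , ac , (λ ab → ¬ab (ab , a≢u , b≢u)) , (λ bc → ¬bc (bc , b≢u , c≢u))

IsW⇒IsW-delete : ∀ G u {a b c} → a ≢ u → b ≢ u → c ≢ u → IsW G a b c → IsW (delete G u) a b c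
IsW⇒IsW-delete G u a≢u b≢u c≢u ((va , vb , vc) , ord , ac , ¬ab , ¬bc) =
  ((va , a≢u) , (vb , b≢u) , (vc , c≢u)) , ord , (ac , a≢u , c≢u) ,
  (λ ab → ¬ab (proj₁ ab)) , (λ bc → ¬bc (proj₁ bc))

WEmpty-delete : ∀ G u → WEmpty G → WEmpty (delete G u)
WEmpty-delete G u empty a b c w = empty a b c (IsW-delete⇒IsW G u w)

IsW⇒first≢ : ∀ G u {a b c} → NeighbourIntervalsCovered G u → IsW G a b c → a ≢ u
IsW⇒first≢ G _ {c = c} covered (_ , (a<b , b<c) , ac , ¬ab , ¬bc) refl
  with a⊓c<b , b<a⊔c ← strictlyBetween⇒⊓<×<⊔ a<b b<c =
  [ ¬ab , (λ cb → ¬bc (sym G cb)) ] (covered c ac _ a⊓c<b b<a⊔c)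

IsW⇒last≢ : ∀ G u {a b c} → NeighbourIntervalsCovered G u → IsW G a b c → c ≢ u
IsW⇒last≢ G _ {a} {b} {c} covered (_ , (a<b , b<c) , ac , ¬ab , ¬bc) refl
  with a⊓c<b , b<a⊔c ← strictlyBetween⇒⊓<×<⊔ a<b b<c =
  [ (λ cb → ¬bc (sym G cb)) , ¬ab ]
    (covered a (sym G ac) _ (subst (_< b) (⊓-comm a c) a⊓c<b) (subst (b <_) (⊔-comm a c) b<a⊔c))

IsW⇒middle≢extreme : ∀ n G u {a b c} → HasVertexSet G n → (u ≡ 1 ⊎ u ≡ n) →
  IsW G a b c → b ≢ u
IsW⇒middle≢extreme n G u {a} vertices (inj₁ refl) ((va , _) , (a<b , _) , _) =
  >⇒≢ (≤-<-trans (proj₁ (proj₁ (vertices a) va)) a<b)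
IsW⇒middle≢extreme n G u {c = c} vertices (inj₂ refl) ((_ , _ , vc) , (_ , b<c) , _) =
  <⇒≢ (<-≤-trans b<c (proj₂ (proj₁ (vertices c) vc)))

proposition5p3 : (n : ℕ) (G : Graph) → HasVertexSet G n →
    (u : ℕ) → (u ≡ 1 ⊎ u ≡ n) →
    (∀ v → v ∈N[ G ] u → ∀ w → (u ⊓ v) < w → w < (u ⊔ v) →
      (w ∈N[ G ] u ⊎ w ∈N[ G ] v)) →
    (WEmpty G ⇔ WEmpty (delete G u))
proposition5p3 n G vertices u extreme covered = mk⇔ (WEmpty-delete G u) emptyAfterDelete⇒empty
  where
  emptyAfterDelete⇒empty : WEmpty (delete G u) → WEmpty G
  emptyAfterDelete⇒empty empty a b c w =
    empty a b c (IsW⇒IsW-delete G u (IsW⇒first≢ G u covered w)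
                                    (IsW⇒middle≢extreme n G u vertices extreme w)
                                    (IsW⇒last≢ G u covered w) w)
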